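{- Let $T=(V,E)$ be a finite rooted tree and let $\mathcal{H}_T$ be the hypergraph on vertex set $V$ whose edges are: (1) for each non-leaf vertex $v$, the set of all children of $v$; and (2) for each leaf $v$, the set of all vertices on the unique path from the root to $v$. If every edge of $\mathcal{H}_T$ has at least two vertices, then $\mathcal{H}_T$ has no proper $2$-coloring, i.e., for every map $c:V\to\{1,2\}$ some edge of $\mathcal{H}_T$ is monochromatic.
   Context: A proper coloring of a hypergraph is a coloring of its vertices such that every edge of size at least two contains two vertices of different colors. -}

module Defs where

open import Data.Nat using (ℕ)
open import Data.Fin using (Fin)
open import Data.List using (List; []; _∷_; map; allFin)
open import Relation.Binary.PropositionalEquality using (_≡_)
open import Relation.Nullary using (¬_)

data Tree : Set where
  node : (k : ℕ) → (Fin k → Tree) → Tree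

data Vertex : Tree → Set where
  root : ∀ {k f} → Vertex (node k f)
  down : ∀ {k f} (i : Fin k) → Vertex (f i) → Vertex (node k f)

rootOf : (t : Tree) → Vertex t
rootOf (node k f) = root

subtree : (t : Tree) → Vertex t → Tree
subtree t root = t
subtree (node k f) (down i v) = subtree (f i) v

numChildren : Tree → ℕ
numChildren (node k _) = k

IsLeaf : (t : Tree) → Vertex t → Set
IsLeaf t v = numChildren (subtree t v) ≡ 0

childrenOf : (t : Tree) → Vertex t → List (Vertex t)
childrenOf (node k f) root = map (λ i → down i (rootOf (f i))) (allFin k)
childrenOf (node k f) (down i v) = map (down i) (childrenOf (f i) v)

pathTo : (t : Tree) → Vertex t → List (Vertex t)
pathTo (node k f) root = root ∷ []
pathTo (node k f) (down i v) = root ∷ map (down i) (pathTo (f i) v)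

data HEdge (t : Tree) : Set where
  childEdge : (v : Vertex t) → ¬ IsLeaf t v → HEdge t
  leafEdge  : (v : Vertex t) → IsLeaf t v → HEdge t

edgeVertices : {t : Tree} → HEdge t → List (Vertex t)
edgeVertices {t} (childEdge v _) = childrenOf t v
edgeVertices {t} (leafEdge v _)  = pathTo t v

-- Walk down from the root, keeping the invariant that every vertex on the path
-- walked so far has the root's colour b. At a non-leaf vertex either some child
-- also has colour b, and the walk continues there, or all children have the
-- other colour and the children edge is monochromatic. If the walk reaches a
-- leaf, its root-to-leaf edge is monochromatic of colour b.
module Submission where

open import Defs
open import Data.Nat using (_≤_; zero; suc)
open import Data.Fin using (Fin; zero; suc; opposite; _≟_)
open import Data.Fin.Properties using (any?)
open import Data.List using (List; length; []; _∷_)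
open import Data.List.Relation.Unary.All using (All; []; _∷_)
open import Data.List.Relation.Unary.All.Properties using (map⁺; tabulate⁺)
open import Data.Product using (∃; Σ; _,_)
open import Relation.Binary.PropositionalEquality using (_≡_; _≢_; refl)
open import Relation.Nullary using (yes; no; ¬_; contradiction)

≢⇒≡opposite : {x b : Fin 2} → x ≢ b → x ≡ opposite b
≢⇒≡opposite {zero}     {zero}     x≢b = contradiction refl x≢b
≢⇒≡opposite {zero}     {suc zero} _   = refl
≢⇒≡opposite {suc zero} {zero}     _   = refl
≢⇒≡opposite {suc zero} {suc zero} x≢b = contradiction refl x≢b

Monochromatic : {A : Set} → (A → Fin 2) → Fin 2 → List A → Set
Monochromatic c b = All (λ u → c u ≡ b)

-- A monochromatic edge of H_t whose colour is prescribed to be b when it is a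
-- root-to-leaf edge; the prescription is what lets it lift to a supertree.
data MonochromaticEdge (t : Tree) (c : Vertex t → Fin 2) (b : Fin 2) : Set where
  children : (v : Vertex t) → ¬ IsLeaf t v → (b′ : Fin 2) →
             Monochromatic c b′ (childrenOf t v) → MonochromaticEdge t c b
  pathToLeaf : (v : Vertex t) → IsLeaf t v →
               Monochromatic c b (pathTo t v) → MonochromaticEdge t c b

monochromaticEdge-down : ∀ {k f} {c : Vertex (node k f) → Fin 2} {b : Fin 2} (i : Fin k) →
                         c root ≡ b → MonochromaticEdge (f i) (λ v → c (down i v)) b →
                         MonochromaticEdge (node k f) c b
monochromaticEdge-down i _      (children v v-nonleaf b′ mono) = children (down i v) v-nonleaf b′ (map⁺ mono)
monochromaticEdge-down i c-root (pathToLeaf v v-leaf mono)     = pathToLeaf (down i v) v-leaf (c-root ∷ map⁺ mono)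

monochromaticEdge : (t : Tree) (c : Vertex t → Fin 2) {b : Fin 2} →
                    c (rootOf t) ≡ b → MonochromaticEdge t c b
monochromaticEdge (node zero f) c c-root = pathToLeaf root refl (c-root ∷ [])
monochromaticEdge (node (suc k) f) c {b} c-root
  with any? (λ i → c (down i (rootOf (f i))) ≟ b)
... | yes (i , c-child) =
  monochromaticEdge-down i c-root (monochromaticEdge (f i) (λ v → c (down i v)) c-child)
... | no no-child-b =
  children root (λ ()) (opposite b)
    (map⁺ (tabulate⁺ (λ i → ≢⇒≡opposite (λ c-child → no-child-b (i , c-child)))))

mainTheorem3 : (t : Tree) → (∀ (e : HEdge t) → 2 ≤ length (edgeVertices e)) → (c : Vertex t → Fin 2) → Σ (HEdge t) (λ e → ∃ (λ (b : Fin 2) → All (λ u → c u ≡ b) (edgeVertices e)))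
mainTheorem3 t _ c with monochromaticEdge t c refl
... | children v v-nonleaf b′ mono = childEdge v v-nonleaf , b′ , mono
... | pathToLeaf v v-leaf mono     = leafEdge v v-leaf , c (rootOf t) , mono
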